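{- Let $\mathbb{F}$ be a field, let $\beta_1,\beta_2$ be nondegenerate symmetric bilinear forms on $\mathbb{F}^2,\mathbb{F}^3$, and let $\beta$ be the bilinear form on $\mathbb{F}^2\otimes\mathbb{F}^3$ with $\beta(a\otimes b,c\otimes d)=\beta_1(a,c)\beta_2(b,d)$. Let $W=\{[x,y,0\,|\,0,z,x]:x,y,z\in\mathbb{F}\}$. Then the orthogonal complement $W^{\perp}$ of $W$ with respect to $\beta$ lies in the same $H_2$-orbit as $\{[x,y,0\,|\,y,z,0]:x,y,z\in\mathbb{F}\}$.
   Context: Identify $\mathbb{F}^2\otimes\mathbb{F}^3$ with $2\times 3$ matrices via $e_i\otimes e_j\mapsto E_{ij}$; $[a_{11},a_{12},a_{13}\,|\,a_{21},a_{22},a_{23}]$ denotes the matrix with rows $(a_{11},a_{12},a_{13})$ and $(a_{21},a_{22},a_{23})$. $H_2=\mathrm{GL}(\mathbb{F}^2)\times\mathrm{GL}(\mathbb{F}^3)$ acts on subspaces via $M\mapsto gMh^{T}$. -}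

module Defs where

open import Level using (Level; _⊔_)
open import Data.Nat using (ℕ; zero; suc)
open import Data.Fin using (Fin; zero; suc)
open import Data.Product using (Σ; ∃; _×_; _,_)
open import Function.Bundles using (_⇔_)
open import Relation.Nullary using (¬_)
open import Algebra.Bundles using (CommutativeRing)

record Field (c ℓ : Level) : Set (Level.suc (c ⊔ ℓ)) where
  field
    commutativeRing : CommutativeRing c ℓ
  open CommutativeRing commutativeRing public
  field
    0≉1     : ¬ (0# ≈ 1#)
    inverse : ∀ x → ¬ (x ≈ 0#) → Σ Carrier (λ y → x * y ≈ 1#)

module _ {c ℓ : Level} (F : Field c ℓ) where
  open Field F using (Carrier; _≈_; _+_; _*_; 0#; 1#)

  Vec : ℕ → Set c
  Vec n = Fin n → Carrier

  Mat : ℕ → ℕ → Set c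
  Mat m n = Fin m → Fin n → Carrier

  Σ[_] : ∀ {n} → (Fin n → Carrier) → Carrier
  Σ[_] {zero}  f = 0#
  Σ[_] {suc n} f = f zero + Σ[ (λ i → f (suc i)) ]

  _≈ᵛ_ : ∀ {n} → Vec n → Vec n → Set ℓ
  u ≈ᵛ v = ∀ i → u i ≈ v i

  _≈ᴹ_ : ∀ {m n} → Mat m n → Mat m n → Set ℓ
  A ≈ᴹ B = ∀ i j → A i j ≈ B i j

  _+ᵛ_ : ∀ {n} → Vec n → Vec n → Vec n
  (u +ᵛ v) i = u i + v i

  _·ᵛ_ : ∀ {n} → Carrier → Vec n → Vec n
  (a ·ᵛ v) i = a * v i

  _⊗ᴹ_ : ∀ {m n p} → Mat m n → Mat n p → Mat m p
  (A ⊗ᴹ B) i k = Σ[ (λ j → A i j * B j k) ]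

  transpose : ∀ {m n} → Mat m n → Mat n m
  transpose A i j = A j i

  identity : ∀ {n} → Mat n n
  identity {suc n} zero    zero    = 1#
  identity {suc n} zero    (suc j) = 0#
  identity {suc n} (suc i) zero    = 0#
  identity {suc n} (suc i) (suc j) = identity i j

  e : ∀ {n} → Fin n → Vec n
  e i = identity i

  Invertible : ∀ {n} → Mat n n → Set (c ⊔ ℓ)
  Invertible {n} g = Σ (Mat n n) λ g' → ((g ⊗ᴹ g') ≈ᴹ identity) × ((g' ⊗ᴹ g) ≈ᴹ identity)

  BilinearForm : ℕ → Set c
  BilinearForm n = Vec n → Vec n → Carrier

  record IsSymmetricBilinear {n} (β : BilinearForm n) : Set (c ⊔ ℓ) where
    field
      cong    : ∀ {u u' v v'} → u ≈ᵛ u' → v ≈ᵛ v' → β u v ≈ β u' v'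
      addˡ    : ∀ u u' v → β (u +ᵛ u') v ≈ β u v + β u' v
      addʳ    : ∀ u v v' → β u (v +ᵛ v') ≈ β u v + β u v'
      scaleˡ  : ∀ a u v → β (a ·ᵛ u) v ≈ a * β u v
      scaleʳ  : ∀ a u v → β u (a ·ᵛ v) ≈ a * β u v
      symm    : ∀ u v → β u v ≈ β v u

  Nondegenerate : ∀ {n} → BilinearForm n → Set (c ⊔ ℓ)
  Nondegenerate {n} β = ∀ v → (∀ w → β v w ≈ 0#) → v ≈ᵛ (λ _ → 0#)

  -- F^2 ⊗ F^3 identified with 2×3 matrices via e_i ⊗ e_j ↦ E_ij.
  -- The bilinear form β with β(a⊗b, c⊗d) = β₁(a,c) β₂(b,d), extended bilinearly:
  -- β(M,N) = Σ_{i,j,k,l} M_ij N_kl β₁(e_i,e_k) β₂(e_j,e_l).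
  tensorForm : BilinearForm 2 → BilinearForm 3 → Mat 2 3 → Mat 2 3 → Carrier
  tensorForm β₁ β₂ M N =
    Σ[ (λ i → Σ[ (λ j → Σ[ (λ k → Σ[ (λ l →
      (M i j * N k l) * (β₁ (e i) (e k) * β₂ (e j) (e l))) ]) ]) ]) ]

  Subset23 : Set (Level.suc (c ⊔ ℓ))
  Subset23 = Mat 2 3 → Set (c ⊔ ℓ)

  -- [a11,a12,a13 | a21,a22,a23]
  mat23 : Carrier → Carrier → Carrier → Carrier → Carrier → Carrier → Mat 2 3
  mat23 a b c' d f g zero zero = a
  mat23 a b c' d f g zero (suc zero) = b
  mat23 a b c' d f g zero (suc (suc zero)) = c'
  mat23 a b c' d f g (suc zero) zero = d
  mat23 a b c' d f g (suc zero) (suc zero) = f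
  mat23 a b c' d f g (suc zero) (suc (suc zero)) = g

  W : Subset23
  W M = Σ Carrier λ x → Σ Carrier λ y → Σ Carrier λ z → M ≈ᴹ mat23 x y 0# 0# z x

  U : Subset23
  U M = Σ Carrier λ x → Σ Carrier λ y → Σ Carrier λ z → M ≈ᴹ mat23 x y 0# y z 0#

  _⊥[_] : Subset23 → (Mat 2 3 → Mat 2 3 → Carrier) → Subset23
  (S ⊥[ b ]) M = ∀ N → S N → b M N ≈ 0#

  -- action of H₂ = GL₂ × GL₃ : M ↦ g M hᵀ, applied to a subspace
  act : Mat 2 2 → Mat 3 3 → Subset23 → Subset23
  act g h S M = Σ (Mat 2 3) λ N → S N × (M ≈ᴹ ((g ⊗ᴹ N) ⊗ᴹ transpose h))

  _≐_ : Subset23 → Subset23 → Set (c ⊔ ℓ)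
  S ≐ T = ∀ M → S M ⇔ T M

  SameH₂Orbit : Subset23 → Subset23 → Set (c ⊔ ℓ)
  SameH₂Orbit S T = Σ (Mat 2 2) λ g → Σ (Mat 3 3) λ h →
    Invertible g × Invertible h × (S ≐ act g h T)

module Submission where

-- W⊥ for β is carried onto a fixed subspace by the Gram matrices
-- G₁ = (β₁(e_i, e_k)) and G₂ = (β₂(e_j, e_l)): writing ⟪ P , N ⟫ = Σ P_kl N_kl
-- for the trace pairing of 2×3 matrices,
--     β(M, N) = ⟪ G₁ᵀ M G₂ , N ⟫,
-- so M ∈ W⊥ exactly when G₁ᵀ M G₂ lies in the trace-pairing complement of W.
-- That complement is {[a,0,c | d,0,-a]} = K U Qᵀ for K = [[0,-1],[1,0]] and
-- the swap Q of the last two columns. Nondegeneracy gives the Gram matrices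
-- trivial kernels, hence (via adjugates, in sizes 2 and 3) inverses, and so
-- W⊥ = (G₁ᵀ)⁻¹ K U Qᵀ G₂⁻¹ is in the H₂-orbit of U.

open import Level using (Level; 0ℓ)
open import Data.Nat as ℕ using (ℕ; zero; suc; _∸_)
open import Data.Fin using (Fin; zero; suc; combine; quotient; remainder)
open import Data.Vec as Vec using (tabulate)
open import Data.Product using (_×_; _,_; proj₁; proj₂)
open import Data.Product.Properties using (≡-dec)
open import Data.Maybe using (Maybe; just; nothing)
open import Data.Empty using (⊥)
open import Relation.Binary.PropositionalEquality as ≡ using (_≡_)
open import Relation.Binary.Bundles using (Setoid)
open import Relation.Nullary using (yes; no; ¬_)
open import Function.Bundles using (_⇔_; mk⇔; Equivalence)
open import Algebra.Bundles using (CommutativeRing; RawRing)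
open import Algebra.Solver.Ring.AlmostCommutativeRing
  using (_-Raw-AlmostCommutative⟶_; fromCommutativeRing)
open import Defs

-- An integer is a pair (a , b) standing for a - b; the operations return the
-- canonical pair (one component zero), so that equal integers are equal pairs
-- and normal forms can be compared by computation. The constants (0 , 0) and
-- (1 , 0) denote 0# and 1# definitionally.
module IntegerCoefficientSolver {c ℓ : Level} (R : CommutativeRing c ℓ) where
  open CommutativeRing R
  open import Algebra.Properties.Ring ring
    using (-‿+-comm; -0#≈0#; ⁻¹-anti-homo‿-; [y-z]x≈yx-zx; x[y-z]≈xy-xz)
  open import Algebra.Properties.CommutativeSemigroup +-commutativeSemigroup
    using (interchange)
  open import Algebra.Properties.Semiring.Mult.TCOptimised semiring
    using (1+×; ×-homo-+; ×1-homo-*) renaming (_×_ to _×′_)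
  open import Relation.Binary.Reasoning.Setoid setoid

  ℤ₂ : Set
  ℤ₂ = ℕ × ℕ

  difference : ℕ → ℕ → ℤ₂
  difference a b = (a ∸ b , b ∸ a)

  Integers : RawRing 0ℓ 0ℓ
  Integers = record
    { Carrier = ℤ₂
    ; _≈_     = _≡_
    ; _+_     = λ { (a , b) (a' , b') → difference (a ℕ.+ a') (b ℕ.+ b') }
    ; _*_     = λ { (a , b) (a' , b') →
                    difference (a ℕ.* a' ℕ.+ b ℕ.* b') (a ℕ.* b' ℕ.+ b ℕ.* a') }
    ; -_      = λ { (a , b) → (b , a) }
    ; 0#      = (0 , 0)
    ; 1#      = (1 , 0)
    }

  ι : ℕ → Carrier
  ι n = n ×′ 1#

  -- the image of an integer in R; no subtraction when the negative part is 0
  ⟦_⟧ℤ : ℤ₂ → Carrier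
  ⟦ a , zero  ⟧ℤ = ι a
  ⟦ a , suc b ⟧ℤ = ι a - ι (suc b)

  diff-+ : ∀ a b c' d → (a + c') - (b + d) ≈ (a - b) + (c' - d)
  diff-+ a b c' d = begin
    (a + c') - (b + d)      ≈⟨ +-congˡ (-‿+-comm b d) ⟨
    (a + c') + (- b + - d)  ≈⟨ interchange a c' (- b) (- d) ⟩
    (a - b) + (c' - d)      ∎

  diff-cancel : ∀ u x y → (u + x) - (u + y) ≈ x - y
  diff-cancel u x y = begin
    (u + x) - (u + y)   ≈⟨ diff-+ u u x y ⟩
    (u - u) + (x - y)   ≈⟨ +-congʳ (-‿inverseʳ u) ⟩
    0# + (x - y)        ≈⟨ +-identityˡ _ ⟩
    x - y               ∎

  diff-* : ∀ x y z w → (x * z + y * w) - (x * w + y * z) ≈ (x - y) * (z - w)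
  diff-* x y z w = begin
    (x * z + y * w) - (x * w + y * z)   ≈⟨ diff-+ (x * z) (x * w) (y * w) (y * z) ⟩
    (x * z - x * w) + (y * w - y * z)   ≈⟨ +-congˡ (⁻¹-anti-homo‿- (y * z) (y * w)) ⟨
    (x * z - x * w) - (y * z - y * w)   ≈⟨ +-cong (x[y-z]≈xy-xz x z w) (-‿cong (x[y-z]≈xy-xz y z w)) ⟨
    x * (z - w) - y * (z - w)           ≈⟨ [y-z]x≈yx-zx (z - w) x y ⟨
    (x - y) * (z - w)                   ∎

  ⟦⟧-difference : ∀ a b → ⟦ a , b ⟧ℤ ≈ ι a - ι b
  ⟦⟧-difference a zero    = sym (trans (+-congˡ -0#≈0#) (+-identityʳ _))
  ⟦⟧-difference a (suc b) = refl

  difference-sound : ∀ a b → ⟦ difference a b ⟧ℤ ≈ ι a - ι b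
  difference-sound zero    zero    = ⟦⟧-difference 0 0
  difference-sound zero    (suc b) = refl
  difference-sound (suc a) zero    = ⟦⟧-difference (suc a) 0
  difference-sound (suc a) (suc b) = begin
    ⟦ difference a b ⟧ℤ          ≈⟨ difference-sound a b ⟩
    ι a - ι b                    ≈⟨ diff-cancel 1# (ι a) (ι b) ⟨
    (1# + ι a) - (1# + ι b)      ≈⟨ +-cong (1+× a 1#) (-‿cong (1+× b 1#)) ⟨
    ι (suc a) - ι (suc b)        ∎

  +-homomorphic : ∀ a b a' b' →
    ⟦ difference (a ℕ.+ a') (b ℕ.+ b') ⟧ℤ ≈ ⟦ a , b ⟧ℤ + ⟦ a' , b' ⟧ℤ
  +-homomorphic a b a' b' = begin
    ⟦ difference (a ℕ.+ a') (b ℕ.+ b') ⟧ℤ   ≈⟨ difference-sound (a ℕ.+ a') (b ℕ.+ b') ⟩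
    ι (a ℕ.+ a') - ι (b ℕ.+ b')             ≈⟨ +-cong (×-homo-+ 1# a a') (-‿cong (×-homo-+ 1# b b')) ⟩
    (ι a + ι a') - (ι b + ι b')             ≈⟨ diff-+ _ _ _ _ ⟩
    (ι a - ι b) + (ι a' - ι b')             ≈⟨ +-cong (⟦⟧-difference a b) (⟦⟧-difference a' b') ⟨
    ⟦ a , b ⟧ℤ + ⟦ a' , b' ⟧ℤ               ∎

  *-homomorphic : ∀ a b a' b' →
    ⟦ difference (a ℕ.* a' ℕ.+ b ℕ.* b') (a ℕ.* b' ℕ.+ b ℕ.* a') ⟧ℤ ≈ ⟦ a , b ⟧ℤ * ⟦ a' , b' ⟧ℤ
  *-homomorphic a b a' b' = begin
    ⟦ difference (a ℕ.* a' ℕ.+ b ℕ.* b') (a ℕ.* b' ℕ.+ b ℕ.* a') ⟧ℤ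
      ≈⟨ difference-sound (a ℕ.* a' ℕ.+ b ℕ.* b') (a ℕ.* b' ℕ.+ b ℕ.* a') ⟩
    ι (a ℕ.* a' ℕ.+ b ℕ.* b') - ι (a ℕ.* b' ℕ.+ b ℕ.* a')
      ≈⟨ +-cong (ι-sum-of-products a a' b b') (-‿cong (ι-sum-of-products a b' b a')) ⟩
    (ι a * ι a' + ι b * ι b') - (ι a * ι b' + ι b * ι a')
      ≈⟨ diff-* _ _ _ _ ⟩
    (ι a - ι b) * (ι a' - ι b')
      ≈⟨ *-cong (⟦⟧-difference a b) (⟦⟧-difference a' b') ⟨
    ⟦ a , b ⟧ℤ * ⟦ a' , b' ⟧ℤ ∎
    where
    ι-sum-of-products : ∀ m n p q → ι (m ℕ.* n ℕ.+ p ℕ.* q) ≈ ι m * ι n + ι p * ι q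
    ι-sum-of-products m n p q =
      trans (×-homo-+ 1# (m ℕ.* n) (p ℕ.* q)) (+-cong (×1-homo-* m n) (×1-homo-* p q))

  -‿homomorphic : ∀ a b → ⟦ b , a ⟧ℤ ≈ - ⟦ a , b ⟧ℤ
  -‿homomorphic a b = begin
    ⟦ b , a ⟧ℤ       ≈⟨ ⟦⟧-difference b a ⟩
    ι b - ι a        ≈⟨ ⁻¹-anti-homo‿- (ι a) (ι b) ⟨
    - (ι a - ι b)    ≈⟨ -‿cong (⟦⟧-difference a b) ⟨
    - ⟦ a , b ⟧ℤ     ∎

  homomorphism : Integers -Raw-AlmostCommutative⟶ fromCommutativeRing R
  homomorphism = record
    { ⟦_⟧    = ⟦_⟧ℤ
    ; +-homo = λ { (a , b) (a' , b') → +-homomorphic a b a' b' }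
    ; *-homo = λ { (a , b) (a' , b') → *-homomorphic a b a' b' }
    ; -‿homo = λ { (a , b) → -‿homomorphic a b }
    ; 0-homo = refl
    ; 1-homo = refl
    }

  equal? : ∀ x y → Maybe (⟦ x ⟧ℤ ≈ ⟦ y ⟧ℤ)
  equal? x y with ≡-dec ℕ._≟_ ℕ._≟_ x y
  ... | yes ≡.refl = just refl
  ... | no _       = nothing

  open import Algebra.Solver.Ring Integers (fromCommutativeRing R) homomorphism equal? public

f0 : ∀ {n} → Fin (suc n)
f0 = zero
f1 : ∀ {n} → Fin (2 ℕ.+ n)
f2 : ∀ {n} → Fin (3 ℕ.+ n)
f1 = suc zero
f2 = suc (suc zero)

-- Cyclic successor on Fin 3; the cofactors of a 3×3 matrix are 2×2 minors
-- on cyclically consecutive rows and columns.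
next : Fin 3 → Fin 3
next zero             = suc zero
next (suc zero)       = suc (suc zero)
next (suc (suc zero)) = zero

fin₂ : ∀ {p} {P : Fin 2 → Set p} → P f0 → P f1 → ∀ i → P i
fin₂ p₀ p₁ zero       = p₀
fin₂ p₀ p₁ (suc zero) = p₁

fin₃ : ∀ {p} {P : Fin 3 → Set p} → P f0 → P f1 → P f2 → ∀ i → P i
fin₃ p₀ p₁ p₂ zero             = p₀
fin₃ p₀ p₁ p₂ (suc zero)       = p₁
fin₃ p₀ p₁ p₂ (suc (suc zero)) = p₂

-- Instantiated at the field (with the sum Σ[_]
-- of Defs) they define the pairing, adjugates, determinants and the auxiliary
-- matrices K and Q; instantiated at polynomial expressions they let the ring
-- solver check identities between them entry by entry. The identity matrix
-- and the 2×3 constructor mirror identity and mat23 of Defs, so that both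
-- instantiations agree definitionally on concrete entries.
module Formulas {a} {A : Set a} (_+_ _*_ : A → A → A) (-_ : A → A) (0# 1# : A)
                (sum : ∀ {n} → (Fin n → A) → A) where
  Matrix : ℕ → ℕ → Set a
  Matrix m n = Fin m → Fin n → A

  _∙_ : ∀ {m n p} → Matrix m n → Matrix n p → Matrix m p
  (X ∙ Y) i k = sum (λ j → X i j * Y j k)

  δ : ∀ {n} → Matrix n n
  δ {suc n} zero    zero    = 1#
  δ {suc n} zero    (suc j) = 0#
  δ {suc n} (suc i) zero    = 0#
  δ {suc n} (suc i) (suc j) = δ i j

  matrix₂₃ : A → A → A → A → A → A → Matrix 2 3
  matrix₂₃ x₀₀ x₀₁ x₀₂ x₁₀ x₁₁ x₁₂ zero       zero             = x₀₀
  matrix₂₃ x₀₀ x₀₁ x₀₂ x₁₀ x₁₁ x₁₂ zero       (suc zero)       = x₀₁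
  matrix₂₃ x₀₀ x₀₁ x₀₂ x₁₀ x₁₁ x₁₂ zero       (suc (suc zero)) = x₀₂
  matrix₂₃ x₀₀ x₀₁ x₀₂ x₁₀ x₁₁ x₁₂ (suc zero) zero             = x₁₀
  matrix₂₃ x₀₀ x₀₁ x₀₂ x₁₀ x₁₁ x₁₂ (suc zero) (suc zero)       = x₁₁
  matrix₂₃ x₀₀ x₀₁ x₀₂ x₁₀ x₁₁ x₁₂ (suc zero) (suc (suc zero)) = x₁₂

  matrix₂₂ : A → A → A → A → Matrix 2 2
  matrix₂₂ x₀₀ x₀₁ x₁₀ x₁₁ zero       zero       = x₀₀
  matrix₂₂ x₀₀ x₀₁ x₁₀ x₁₁ zero       (suc zero) = x₀₁
  matrix₂₂ x₀₀ x₀₁ x₁₀ x₁₁ (suc zero) zero       = x₁₀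
  matrix₂₂ x₀₀ x₀₁ x₁₀ x₁₁ (suc zero) (suc zero) = x₁₁

  ⟪_,_⟫ : ∀ {m n} → Matrix m n → Matrix m n → A
  ⟪ P , N ⟫ = sum (λ k → sum (λ l → P k l * N k l))

  det₂ : Matrix 2 2 → A
  det₂ X = (X f0 f0 * X f1 f1) + (- (X f0 f1 * X f1 f0))

  adj₂ : Matrix 2 2 → Matrix 2 2
  adj₂ X = matrix₂₂ (X f1 f1) (- X f0 f1) (- X f1 f0) (X f0 f0)

  minor : Matrix 3 3 → Fin 3 → Fin 3 → Fin 3 → A
  minor X a r q =
    (X a (next q) * X r (next (next q))) + (- (X a (next (next q)) * X r (next q)))

  adj₃ : Matrix 3 3 → Matrix 3 3
  adj₃ X q p = minor X (next p) (next (next p)) q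

  det₃ : Matrix 3 3 → A
  det₃ X = sum (λ k → X f0 k * adj₃ X k f0)

  K K⁻¹ : Matrix 2 2
  K   = matrix₂₂ 0# (- 1#) 1# 0#
  K⁻¹ = matrix₂₂ 0# 1# (- 1#) 0#

  Q : Matrix 3 3
  Q zero             zero             = 1#
  Q (suc zero)       (suc (suc zero)) = 1#
  Q (suc (suc zero)) (suc zero)       = 1#
  Q _                _                = 0#

module LinearAlgebra {c ℓ : Level} (F : Field c ℓ) where
  open Field F hiding (zero)
  open import Algebra.Properties.Ring ring
    using (-‿distribˡ-*; -0#≈0#; -‿involutive; +-inverseʳ-unique)
  open import Algebra.Properties.CommutativeSemigroup +-commutativeSemigroup using (interchange)
  open import Algebra.Properties.CommutativeSemigroup *-commutativeSemigroup using (x∙yz≈y∙xz)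
  open IntegerCoefficientSolver commutativeRing
    using (Polynomial; con; var; ⟦_⟧; ⟦_⟧↓; prove; solve; _:=_; _:+_; _:*_; _:-_; :-_)
  import Relation.Binary.Reasoning.Setoid as SetoidReasoning
  module ≈-Reasoning = SetoidReasoning setoid

  ∑ : ∀ {n} → (Fin n → Carrier) → Carrier
  ∑ = Σ[_] F

  polySum : ∀ {k n} → (Fin n → Polynomial k) → Polynomial k
  polySum {n = zero}  f = con (0 , 0)
  polySum {n = suc n} f = f zero :+ polySum (λ i → f (suc i))

  open Formulas _+_ _*_ -_ 0# 1# ∑ public
    using (⟪_,_⟫; det₂; adj₂; minor; adj₃; det₃; K; K⁻¹; Q)
  module Poly {k : ℕ} = Formulas {A = Polynomial k} _:+_ _:*_ :-_ (con (0 , 0)) (con (1 , 0)) polySum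

  infixl 7 _⊗_
  infix  4 _≈ₘ_
  _⊗_ : ∀ {m n p} → Mat F m n → Mat F n p → Mat F m p
  _⊗_ = _⊗ᴹ_ F
  _≈ₘ_ : ∀ {m n} → Mat F m n → Mat F m n → Set ℓ
  _≈ₘ_ = _≈ᴹ_ F
  I : ∀ {n} → Mat F n n
  I = identity F
  tr : ∀ {m n} → Mat F m n → Mat F n m
  tr = transpose F
  _·I : ∀ {n} → Carrier → Mat F n n
  (d ·I) i j = d * I i j

  variables : ∀ {m n} → Fin m → Fin n → Polynomial (m ℕ.* n)
  variables i j = var (combine i j)

  entries : ∀ {m n} → Mat F m n → Vec.Vec Carrier (m ℕ.* n)
  entries {m} {n} A = tabulate (λ k → A (quotient n k) (remainder {m} n k))

  -- An identity L = R between matrices of polynomial expressions, read in the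
  -- environment ρ: each entry holds as soon as both sides have the same normal
  -- form, which for concrete indices is checked by computation (refl).
  module Entrywise {k m n} (ρ : Vec.Vec Carrier k) (L R : Fin m → Fin n → Polynomial k) where
    entry : ∀ i j → ⟦ L i j ⟧↓ ρ ≈ ⟦ R i j ⟧↓ ρ → ⟦ L i j ⟧ ρ ≈ ⟦ R i j ⟧ ρ
    entry i j = prove ρ (L i j) (R i j)

  ∑-cong : ∀ {n} {f g : Fin n → Carrier} → (∀ i → f i ≈ g i) → ∑ f ≈ ∑ g
  ∑-cong {zero}  f≈g = refl
  ∑-cong {suc n} f≈g = +-cong (f≈g zero) (∑-cong (λ i → f≈g (suc i)))

  ∑-zero : ∀ {n} → ∑ {n} (λ _ → 0#) ≈ 0#
  ∑-zero {zero}  = refl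
  ∑-zero {suc n} = trans (+-identityˡ _) (∑-zero {n})

  ∑-+ : ∀ {n} (f g : Fin n → Carrier) → ∑ (λ i → f i + g i) ≈ ∑ f + ∑ g
  ∑-+ {zero}  f g = sym (+-identityˡ 0#)
  ∑-+ {suc n} f g = trans (+-congˡ (∑-+ (λ i → f (suc i)) (λ i → g (suc i))))
                          (interchange _ _ _ _)

  ∑-*ˡ : ∀ {n} a (f : Fin n → Carrier) → a * ∑ f ≈ ∑ (λ i → a * f i)
  ∑-*ˡ {zero}  a f = zeroʳ a
  ∑-*ˡ {suc n} a f = trans (distribˡ _ _ _) (+-congˡ (∑-*ˡ a (λ i → f (suc i))))

  ∑-*ʳ : ∀ {n} a (f : Fin n → Carrier) → ∑ f * a ≈ ∑ (λ i → f i * a)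
  ∑-*ʳ {zero}  a f = zeroˡ a
  ∑-*ʳ {suc n} a f = trans (distribʳ _ _ _) (+-congˡ (∑-*ʳ a (λ i → f (suc i))))

  ∑-swap : ∀ {m n} (f : Fin m → Fin n → Carrier) →
           ∑ (λ i → ∑ (λ j → f i j)) ≈ ∑ (λ j → ∑ (λ i → f i j))
  ∑-swap {zero}  {n} f = sym (∑-zero {n})
  ∑-swap {suc m} f = trans (+-congˡ (∑-swap (λ i j → f (suc i) j)))
                           (sym (∑-+ (λ j → f zero j) (λ j → ∑ (λ i → f (suc i) j))))

  ∑-δˡ : ∀ {n} (i : Fin n) (f : Fin n → Carrier) → ∑ (λ j → I i j * f j) ≈ f i
  ∑-δˡ {suc n} zero f =
    trans (+-cong (*-identityˡ _) (trans (∑-cong {n} (λ j → zeroˡ (f (suc j)))) (∑-zero {n})))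
          (+-identityʳ _)
  ∑-δˡ {suc n} (suc i) f = trans (+-cong (zeroˡ _) (∑-δˡ i (λ j → f (suc j)))) (+-identityˡ _)

  ∑-δʳ : ∀ {n} (k : Fin n) (f : Fin n → Carrier) → ∑ (λ j → f j * I j k) ≈ f k
  ∑-δʳ {suc n} zero f =
    trans (+-cong (*-identityʳ _) (trans (∑-cong {n} (λ j → zeroʳ (f (suc j)))) (∑-zero {n})))
          (+-identityʳ _)
  ∑-δʳ {suc n} (suc k) f = trans (+-cong (zeroʳ _) (∑-δʳ k (λ j → f (suc j)))) (+-identityˡ _)

  I-sym : ∀ {n} (i j : Fin n) → I i j ≈ I j i
  I-sym zero    zero    = refl
  I-sym zero    (suc j) = refl
  I-sym (suc i) zero    = refl
  I-sym (suc i) (suc j) = I-sym i j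

  ≈ₘ-setoid : ℕ → ℕ → Setoid c ℓ
  ≈ₘ-setoid m n = record
    { Carrier       = Mat F m n
    ; _≈_           = _≈ₘ_
    ; isEquivalence = record
      { refl  = λ _ _ → refl
      ; sym   = λ A≈B i j → sym (A≈B i j)
      ; trans = λ A≈B B≈C i j → trans (A≈B i j) (B≈C i j)
      }
    }

  module ≈ₘ {m n : ℕ} = Setoid (≈ₘ-setoid m n)
  module ≈ₘ-Reasoning {m n : ℕ} = SetoidReasoning (≈ₘ-setoid m n)

  ⊗-cong : ∀ {m n p} {A A' : Mat F m n} {B B' : Mat F n p} → A ≈ₘ A' → B ≈ₘ B' → A ⊗ B ≈ₘ A' ⊗ B'
  ⊗-cong {n = n} A≈A' B≈B' i k = ∑-cong {n} (λ j → *-cong (A≈A' i j) (B≈B' j k))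

  ⊗-congˡ : ∀ {m n p} {A A' : Mat F m n} (B : Mat F n p) → A ≈ₘ A' → A ⊗ B ≈ₘ A' ⊗ B
  ⊗-congˡ B A≈A' = ⊗-cong A≈A' ≈ₘ.refl

  ⊗-congʳ : ∀ {m n p} (A : Mat F m n) {B B' : Mat F n p} → B ≈ₘ B' → A ⊗ B ≈ₘ A ⊗ B'
  ⊗-congʳ A B≈B' = ⊗-cong ≈ₘ.refl B≈B'

  ⊗-assoc : ∀ {m n p q} (A : Mat F m n) (B : Mat F n p) (C : Mat F p q) →
            (A ⊗ B) ⊗ C ≈ₘ A ⊗ (B ⊗ C)
  ⊗-assoc {n = n} {p} A B C i l = begin
    ∑ (λ k → ∑ (λ j → A i j * B j k) * C k l)
      ≈⟨ ∑-cong {p} (λ k → trans (∑-*ʳ (C k l) (λ j → A i j * B j k))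
                                 (∑-cong {n} (λ j → *-assoc _ _ _))) ⟩
    ∑ (λ k → ∑ (λ j → A i j * (B j k * C k l)))
      ≈⟨ ∑-swap {p} {n} (λ k j → A i j * (B j k * C k l)) ⟩
    ∑ (λ j → ∑ (λ k → A i j * (B j k * C k l)))
      ≈⟨ ∑-cong {n} (λ j → ∑-*ˡ (A i j) (λ k → B j k * C k l)) ⟨
    ∑ (λ j → A i j * ∑ (λ k → B j k * C k l)) ∎
    where open ≈-Reasoning

  ⊗-identityˡ : ∀ {m n} (A : Mat F m n) → I ⊗ A ≈ₘ A
  ⊗-identityˡ A i k = ∑-δˡ i (λ j → A j k)

  ⊗-identityʳ : ∀ {m n} (A : Mat F m n) → A ⊗ I ≈ₘ A
  ⊗-identityʳ A i k = ∑-δʳ k (λ j → A i j)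

  tr-⊗ : ∀ {m n p} (A : Mat F m n) (B : Mat F n p) → tr (A ⊗ B) ≈ₘ tr B ⊗ tr A
  tr-⊗ {n = n} A B k i = ∑-cong {n} (λ j → *-comm _ _)

  cancel-middle : ∀ {m n p q} (P : Mat F m n) (X : Mat F n p) (Y : Mat F p n) (R : Mat F n q) →
                  X ⊗ Y ≈ₘ I → (P ⊗ X) ⊗ (Y ⊗ R) ≈ₘ P ⊗ R
  cancel-middle P X Y R XY≈I = begin
    (P ⊗ X) ⊗ (Y ⊗ R)   ≈⟨ ⊗-assoc P X (Y ⊗ R) ⟩
    P ⊗ (X ⊗ (Y ⊗ R))   ≈⟨ ⊗-congʳ P (⊗-assoc X Y R) ⟨
    P ⊗ ((X ⊗ Y) ⊗ R)   ≈⟨ ⊗-congʳ P (⊗-congˡ R XY≈I) ⟩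
    P ⊗ (I ⊗ R)         ≈⟨ ⊗-congʳ P (⊗-identityˡ R) ⟩
    P ⊗ R               ∎
    where open ≈ₘ-Reasoning

  unsandwich : ∀ {m n} (L' L : Mat F m m) (X : Mat F m n) (R R' : Mat F n n) →
               L' ⊗ L ≈ₘ I → R ⊗ R' ≈ₘ I → (L' ⊗ ((L ⊗ X) ⊗ R)) ⊗ R' ≈ₘ X
  unsandwich L' L X R R' L'L≈I RR'≈I = begin
    (L' ⊗ ((L ⊗ X) ⊗ R)) ⊗ R'   ≈⟨ ⊗-congˡ R' (⊗-assoc L' (L ⊗ X) R) ⟨
    ((L' ⊗ (L ⊗ X)) ⊗ R) ⊗ R'   ≈⟨ ⊗-assoc (L' ⊗ (L ⊗ X)) R R' ⟩
    (L' ⊗ (L ⊗ X)) ⊗ (R ⊗ R')   ≈⟨ ⊗-cong (≈ₘ.sym (⊗-assoc L' L X)) RR'≈I ⟩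
    ((L' ⊗ L) ⊗ X) ⊗ I          ≈⟨ ⊗-identityʳ _ ⟩
    (L' ⊗ L) ⊗ X                ≈⟨ ⊗-congˡ X L'L≈I ⟩
    I ⊗ X                       ≈⟨ ⊗-identityˡ X ⟩
    X                           ∎
    where open ≈ₘ-Reasoning

  invertible-⊗ : ∀ {n} (A B : Mat F n n) → Invertible F A → Invertible F B → Invertible F (A ⊗ B)
  invertible-⊗ A B (A' , AA' , A'A) (B' , BB' , B'B) =
    B' ⊗ A' , ≈ₘ.trans (cancel-middle A B B' A' BB') AA' , ≈ₘ.trans (cancel-middle B' A' A B A'A) B'B

  invertible-tr : ∀ {n} (A : Mat F n n) → Invertible F A → Invertible F (tr A)
  invertible-tr A (A' , AA' , A'A) = tr A' , transposed A'A , transposed AA'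
    where
    transposed : ∀ {X Y : Mat F _ _} → X ⊗ Y ≈ₘ I → tr Y ⊗ tr X ≈ₘ I
    transposed {X} {Y} XY≈I i j = trans (sym (tr-⊗ X Y i j)) (trans (XY≈I j i) (I-sym j i))

  _▸_ : ∀ {m n} → Mat F m n → Defs.Vec F n → Defs.Vec F m
  (A ▸ v) i = ∑ (λ j → A i j * v j)

  TrivialKernel : ∀ {m n} → Mat F m n → Set (c Level.⊔ ℓ)
  TrivialKernel A = ∀ v → (∀ i → (A ▸ v) i ≈ 0#) → ∀ j → v j ≈ 0#

  ▸-combination : ∀ {m n} (A : Mat F m n) x s y t i →
                  (A ▸ (λ j → x * I s j + y * I t j)) i ≈ x * A i s + y * A i t
  ▸-combination {n = n} A x s y t i = begin
    ∑ (λ j → A i j * (x * I s j + y * I t j))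
      ≈⟨ ∑-cong {n} (λ j → distribˡ (A i j) _ _) ⟩
    ∑ (λ j → A i j * (x * I s j) + A i j * (y * I t j))
      ≈⟨ ∑-+ (λ j → A i j * (x * I s j)) (λ j → A i j * (y * I t j)) ⟩
    ∑ (λ j → A i j * (x * I s j)) + ∑ (λ j → A i j * (y * I t j))
      ≈⟨ +-cong (column x s) (column y t) ⟩
    x * A i s + y * A i t ∎
    where
    open ≈-Reasoning
    column : ∀ z k → ∑ (λ j → A i j * (z * I k j)) ≈ z * A i k
    column z k = begin
      ∑ (λ j → A i j * (z * I k j))   ≈⟨ ∑-cong {n} (λ j → x∙yz≈y∙xz (A i j) z (I k j)) ⟩
      ∑ (λ j → z * (A i j * I k j))   ≈⟨ ∑-*ˡ z (λ j → A i j * I k j) ⟨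
      z * ∑ (λ j → A i j * I k j)     ≈⟨ *-congˡ (∑-cong {n} (λ j → *-congˡ (I-sym k j))) ⟩
      z * ∑ (λ j → A i j * I j k)     ≈⟨ *-congˡ (∑-δʳ k (A i)) ⟩
      z * A i k                       ∎

  trivial-kernel⇒nonzero : ∀ {m n} (A : Mat F m (suc n)) → TrivialKernel A → (∀ i j → A i j ≈ 0#) → ⊥
  trivial-kernel⇒nonzero {n = n} A ker A≈0 = 0≉1 (sym (ker (I f0) e₀∈ker f0))
    where
    e₀∈ker : ∀ i → (A ▸ I f0) i ≈ 0#
    e₀∈ker i = trans (∑-cong {suc n} (λ j → trans (*-congʳ (A≈0 i j)) (zeroˡ (I f0 j))))
                     (∑-zero {suc n})

  -- if A Adj = d I with d = 0, the columns of Adj lie in the kernel of A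
  adjugate-vanishes : ∀ {n} (A Adj : Mat F n n) {d} → TrivialKernel A →
                      A ⊗ Adj ≈ₘ d ·I → d ≈ 0# → ∀ i j → Adj i j ≈ 0#
  adjugate-vanishes A Adj ker AAdj≈dI d≈0 i j =
    ker (λ k → Adj k j) (λ k → trans (AAdj≈dI k j) (trans (*-congʳ d≈0) (zeroˡ _))) i

  invertible-from-adjugate : ∀ {n} (A Adj : Mat F n n) {d} →
    Adj ⊗ A ≈ₘ d ·I → A ⊗ Adj ≈ₘ d ·I → ¬ (d ≈ 0#) → Invertible F A
  invertible-from-adjugate {n} A Adj {d} AdjA≈dI AAdj≈dI d≉0 with inverse d d≉0
  ... | d⁻¹ , dd⁻¹≈1 = scaled , right , left
    where
    scaled : Mat F n n
    scaled i j = d⁻¹ * Adj i j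
    unscale : ∀ (X Y : Mat F n n) {Z : Mat F n n} →
              (∀ i j → Z i j ≈ d⁻¹ * (X ⊗ Y) i j) → X ⊗ Y ≈ₘ d ·I → Z ≈ₘ I
    unscale X Y {Z} Z≈ XY≈dI i j = begin
      Z i j                 ≈⟨ Z≈ i j ⟩
      d⁻¹ * (X ⊗ Y) i j     ≈⟨ *-congˡ (XY≈dI i j) ⟩
      d⁻¹ * (d * I i j)     ≈⟨ *-assoc _ _ _ ⟨
      (d⁻¹ * d) * I i j     ≈⟨ *-congʳ (trans (*-comm _ _) dd⁻¹≈1) ⟩
      1# * I i j            ≈⟨ *-identityˡ _ ⟩
      I i j                 ∎
      where open ≈-Reasoning
    right : A ⊗ scaled ≈ₘ I
    right = unscale A Adj (λ i j → trans (∑-cong {n} (λ k → x∙yz≈y∙xz _ _ _))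
                                            (sym (∑-*ˡ d⁻¹ (λ k → A i k * Adj k j)))) AAdj≈dI
    left : scaled ⊗ A ≈ₘ I
    left = unscale Adj A (λ i j → trans (∑-cong {n} (λ k → *-assoc _ _ _))
                                           (sym (∑-*ˡ d⁻¹ (λ k → Adj i k * A k j)))) AdjA≈dI

  negated-zero : ∀ {x} → - x ≈ 0# → x ≈ 0#
  negated-zero {x} -x≈0 = trans (sym (-‿involutive x)) (trans (-‿cong -x≈0) -0#≈0#)

  adj₂-left : (A : Mat F 2 2) → adj₂ A ⊗ A ≈ₘ det₂ A ·I
  adj₂-left A = fin₂ (fin₂ (entry f0 f0 refl) (entry f0 f1 refl))
                     (fin₂ (entry f1 f0 refl) (entry f1 f1 refl))
    where
    X : Fin 2 → Fin 2 → Polynomial 4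
    X = variables
    open Entrywise (entries A) (Poly.adj₂ X Poly.∙ X) (λ i j → Poly.det₂ X :* Poly.δ i j)

  adj₂-right : (A : Mat F 2 2) → A ⊗ adj₂ A ≈ₘ det₂ A ·I
  adj₂-right A = fin₂ (fin₂ (entry f0 f0 refl) (entry f0 f1 refl))
                      (fin₂ (entry f1 f0 refl) (entry f1 f1 refl))
    where
    X : Fin 2 → Fin 2 → Polynomial 4
    X = variables
    open Entrywise (entries A) (X Poly.∙ Poly.adj₂ X) (λ i j → Poly.det₂ X :* Poly.δ i j)

  -- the entries of adj₂ A are those of A up to sign
  adj₂-vanishes⇒zero : (A : Mat F 2 2) → (∀ i j → adj₂ A i j ≈ 0#) → ∀ i j → A i j ≈ 0#
  adj₂-vanishes⇒zero A adj≈0 = fin₂ (fin₂ (adj≈0 f1 f1) (negated-zero (adj≈0 f0 f1)))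
                                    (fin₂ (negated-zero (adj≈0 f1 f0)) (adj≈0 f0 f0))

  invertible₂ : (A : Mat F 2 2) → TrivialKernel A → Invertible F A
  invertible₂ A ker = invertible-from-adjugate A (adj₂ A) (adj₂-left A) (adj₂-right A) det≉0
    where
    det≉0 : ¬ (det₂ A ≈ 0#)
    det≉0 det≈0 = trivial-kernel⇒nonzero A ker
      (adj₂-vanishes⇒zero A (adjugate-vanishes A (adj₂ A) ker (adj₂-right A) det≈0))

  adj₃-left : (A : Mat F 3 3) → adj₃ A ⊗ A ≈ₘ det₃ A ·I
  adj₃-left A = fin₃ (fin₃ (entry f0 f0 refl) (entry f0 f1 refl) (entry f0 f2 refl))
                     (fin₃ (entry f1 f0 refl) (entry f1 f1 refl) (entry f1 f2 refl))
                     (fin₃ (entry f2 f0 refl) (entry f2 f1 refl) (entry f2 f2 refl))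
    where
    X : Fin 3 → Fin 3 → Polynomial 9
    X = variables
    open Entrywise (entries A) (Poly.adj₃ X Poly.∙ X) (λ i j → Poly.det₃ X :* Poly.δ i j)

  adj₃-right : (A : Mat F 3 3) → A ⊗ adj₃ A ≈ₘ det₃ A ·I
  adj₃-right A = fin₃ (fin₃ (entry f0 f0 refl) (entry f0 f1 refl) (entry f0 f2 refl))
                      (fin₃ (entry f1 f0 refl) (entry f1 f1 refl) (entry f1 f2 refl))
                      (fin₃ (entry f2 f0 refl) (entry f2 f1 refl) (entry f2 f2 refl))
    where
    X : Fin 3 → Fin 3 → Polynomial 9
    X = variables
    open Entrywise (entries A) (X Poly.∙ Poly.adj₃ X) (λ i j → Poly.det₃ X :* Poly.δ i j)

  minor-diagonal : ∀ (A : Mat F 3 3) a q → minor A a a q ≈ 0#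
  minor-diagonal A a q = xy-yx (A a (next q)) (A a (next (next q)))
    where
    xy-yx : ∀ x y → x * y - y * x ≈ 0#
    xy-yx = solve 2 (λ x y → x :* y :- y :* x := con (0 , 0)) refl

  minor-swap : ∀ (A : Mat F 3 3) a r q → minor A a r q ≈ - minor A r a q
  minor-swap A a r q = swap (A a (next q)) (A r (next (next q))) (A a (next (next q))) (A r (next q))
    where
    swap : ∀ x y z w → x * y - z * w ≈ - (w * z - y * x)
    swap = solve 4 (λ x y z w → x :* y :- z :* w := :- (w :* z :- y :* x)) refl

  minor-reversed : ∀ (A : Mat F 3 3) a r q → minor A r a q ≈ 0# → minor A a r q ≈ 0#
  minor-reversed A a r q m≈0 = trans (minor-swap A a r q) (trans (-‿cong m≈0) -0#≈0#)

  -- The entries of adj₃ A are the minors on the row pairs (p+1, p+2); the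
  -- minors on the reversed pairs are their negatives, and those on a repeated
  -- row vanish.
  minors-vanish : ∀ (A : Mat F 3 3) → (∀ q p → adj₃ A q p ≈ 0#) → ∀ a r q → minor A a r q ≈ 0#
  minors-vanish A adj≈0 zero             zero             q = minor-diagonal A f0 q
  minors-vanish A adj≈0 zero             (suc zero)       q = adj≈0 q f2
  minors-vanish A adj≈0 zero             (suc (suc zero)) q = minor-reversed A f0 f2 q (adj≈0 q f1)
  minors-vanish A adj≈0 (suc zero)       zero             q = minor-reversed A f1 f0 q (adj≈0 q f2)
  minors-vanish A adj≈0 (suc zero)       (suc zero)       q = minor-diagonal A f1 q
  minors-vanish A adj≈0 (suc zero)       (suc (suc zero)) q = adj≈0 q f0
  minors-vanish A adj≈0 (suc (suc zero)) zero             q = adj≈0 q f1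
  minors-vanish A adj≈0 (suc (suc zero)) (suc zero)       q = minor-reversed A f2 f1 q (adj≈0 q f0)
  minors-vanish A adj≈0 (suc (suc zero)) (suc (suc zero)) q = minor-diagonal A f2 q

  -- v = A_{a,q+1} e_{q+2} - A_{a,q+2} e_{q+1}: the entries of A v are minors of A
  cofactor-vector : Mat F 3 3 → Fin 3 → Fin 3 → Defs.Vec F 3
  cofactor-vector A a q j =
    A a (next q) * I (next (next q)) j + (- A a (next (next q))) * I (next q) j

  cofactor-vector-image : ∀ (A : Mat F 3 3) a q r → (A ▸ cofactor-vector A a q) r ≈ minor A a r q
  cofactor-vector-image A a q r =
    trans (▸-combination A (A a (next q)) (next (next q)) (- A a (next (next q))) (next q) r)
          (+-congˡ (sym (-‿distribˡ-* (A a (next (next q))) (A r (next q)))))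

  cofactor-vector-component : ∀ (A : Mat F 3 3) a q → cofactor-vector A a q (next (next q)) ≈ A a (next q)
  cofactor-vector-component A a = fin₃ (x1+y0 _ _) (x1+y0 _ _) (x1+y0 _ _)
    where
    x1+y0 : ∀ x y → x * 1# + y * 0# ≈ x
    x1+y0 x y = trans (+-cong (*-identityʳ x) (zeroʳ y)) (+-identityʳ x)

  -- if adj₃ A = 0, every cofactor vector lies in the kernel of A; when the
  -- kernel is trivial this forces every entry of A to vanish
  adj₃-vanishes⇒zero : ∀ (A : Mat F 3 3) → TrivialKernel A →
                       (∀ q p → adj₃ A q p ≈ 0#) → ∀ i j → A i j ≈ 0#
  adj₃-vanishes⇒zero A ker adj≈0 a = fin₃ (column f2) (column f0) (column f1)
    where
    column : ∀ q → A a (next q) ≈ 0#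
    column q = trans (sym (cofactor-vector-component A a q))
                     (ker (cofactor-vector A a q)
                          (λ r → trans (cofactor-vector-image A a q r) (minors-vanish A adj≈0 a r q))
                          (next (next q)))

  invertible₃ : (A : Mat F 3 3) → TrivialKernel A → Invertible F A
  invertible₃ A ker = invertible-from-adjugate A (adj₃ A) (adj₃-left A) (adj₃-right A) det≉0
    where
    det≉0 : ¬ (det₃ A ≈ 0#)
    det≉0 det≈0 = trivial-kernel⇒nonzero A ker
      (adj₃-vanishes⇒zero A ker (adjugate-vanishes A (adj₃ A) ker (adj₃-right A) det≈0))

  gram : ∀ {n} → BilinearForm F n → Mat F n n
  gram β i k = β (e F i) (e F k)

  module _ {n} {β : BilinearForm F n} (isβ : IsSymmetricBilinear F β) where
    open IsSymmetricBilinear isβ renaming (cong to β-cong)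

    β-∑ˡ : ∀ {k} (u : Fin k → Defs.Vec F n) w → β (λ j → ∑ (λ i → u i j)) w ≈ ∑ (λ i → β (u i) w)
    β-∑ˡ {zero} u w = begin
      β (λ _ → 0#) w          ≈⟨ β-cong (λ _ → sym (zeroˡ 0#)) (λ _ → refl) ⟩
      β (λ _ → 0# * 0#) w     ≈⟨ scaleˡ 0# (λ _ → 0#) w ⟩
      0# * β (λ _ → 0#) w     ≈⟨ zeroˡ _ ⟩
      0#                      ∎
      where open ≈-Reasoning
    β-∑ˡ {suc k} u w = trans (addˡ (u zero) (λ j → ∑ (λ i → u (suc i) j)) w)
                             (+-congˡ (β-∑ˡ (λ i → u (suc i)) w))

    expansionˡ : ∀ v w → β v w ≈ ∑ (λ i → v i * β (e F i) w)
    expansionˡ v w = begin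
      β v w                               ≈⟨ β-cong (λ j → sym (∑-δʳ j v)) (λ _ → refl) ⟩
      β (λ j → ∑ (λ i → v i * I i j)) w   ≈⟨ β-∑ˡ (λ i j → v i * I i j) w ⟩
      ∑ (λ i → β (λ j → v i * I i j) w)   ≈⟨ ∑-cong {n} (λ i → scaleˡ (v i) (e F i) w) ⟩
      ∑ (λ i → v i * β (e F i) w)         ∎
      where open ≈-Reasoning

    gram-kernel : Nondegenerate F β → TrivialKernel (gram β)
    gram-kernel nondegenerate v Gv≈0 = nondegenerate v orthogonal
      where
      open ≈-Reasoning
      gram-row : ∀ k → β (e F k) v ≈ (gram β ▸ v) k
      gram-row k = begin
        β (e F k) v                         ≈⟨ symm _ _ ⟩
        β v (e F k)                         ≈⟨ expansionˡ v (e F k) ⟩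
        ∑ (λ i → v i * β (e F i) (e F k))   ≈⟨ ∑-cong {n} (λ i → trans (*-comm _ _) (*-congʳ (symm _ _))) ⟩
        ∑ (λ i → β (e F k) (e F i) * v i)   ∎
      orthogonal : ∀ w → β v w ≈ 0#
      orthogonal w = begin
        β v w                         ≈⟨ symm v w ⟩
        β w v                         ≈⟨ expansionˡ w v ⟩
        ∑ (λ k → w k * β (e F k) v)   ≈⟨ ∑-cong {n} (λ k → trans (*-congˡ (trans (gram-row k) (Gv≈0 k)))
                                                                 (zeroʳ _)) ⟩
        ∑ {n} (λ _ → 0#)              ≈⟨ ∑-zero {n} ⟩
        0#                            ∎

  pairing-cong : ∀ {m n} {P P' N N' : Mat F m n} → P ≈ₘ P' → N ≈ₘ N' → ⟪ P , N ⟫ ≈ ⟪ P' , N' ⟫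
  pairing-cong {m} {n} P≈P' N≈N' = ∑-cong {m} (λ k → ∑-cong {n} (λ l → *-cong (P≈P' k l) (N≈N' k l)))

  adjointˡ : ∀ {m n p} (M : Mat F m n) (A : Mat F m p) (N : Mat F p n) → ⟪ M , A ⊗ N ⟫ ≈ ⟪ tr A ⊗ M , N ⟫
  adjointˡ {m} {n} {p} M A N = begin
    ∑ (λ i → ∑ (λ j → M i j * ∑ (λ k → A i k * N k j)))
      ≈⟨ ∑-cong {m} (λ i → ∑-cong {n} (λ j → trans (∑-*ˡ (M i j) (λ k → A i k * N k j))
                                                    (∑-cong {p} (λ k → x∙yz≈y∙xz _ _ _)))) ⟩
    ∑ (λ i → ∑ (λ j → ∑ (λ k → A i k * (M i j * N k j))))
      ≈⟨ ∑-cong {m} (λ i → ∑-swap {n} {p} (λ j k → A i k * (M i j * N k j))) ⟩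
    ∑ (λ i → ∑ (λ k → ∑ (λ j → A i k * (M i j * N k j))))
      ≈⟨ ∑-swap {m} {p} (λ i k → ∑ (λ j → A i k * (M i j * N k j))) ⟩
    ∑ (λ k → ∑ (λ i → ∑ (λ j → A i k * (M i j * N k j))))
      ≈⟨ ∑-cong {p} (λ k → ∑-swap {m} {n} (λ i j → A i k * (M i j * N k j))) ⟩
    ∑ (λ k → ∑ (λ j → ∑ (λ i → A i k * (M i j * N k j))))
      ≈⟨ ∑-cong {p} (λ k → ∑-cong {n} (λ j → trans (∑-cong {m} (λ i → sym (*-assoc _ _ _)))
                                                    (sym (∑-*ʳ (N k j) (λ i → A i k * M i j))))) ⟩
    ∑ (λ k → ∑ (λ j → ∑ (λ i → A i k * M i j) * N k j)) ∎
    where open ≈-Reasoning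

  adjointʳ : ∀ {m n p} (M : Mat F m n) (N : Mat F m p) (B : Mat F p n) → ⟪ M , N ⊗ B ⟫ ≈ ⟪ M ⊗ tr B , N ⟫
  adjointʳ {m} {n} {p} M N B = ∑-cong {m} (λ i → begin
    ∑ (λ j → M i j * ∑ (λ l → N i l * B l j))
      ≈⟨ ∑-cong {n} (λ j → trans (∑-*ˡ (M i j) (λ l → N i l * B l j))
                                 (∑-cong {p} (λ l → regroup (M i j) (N i l) (B l j)))) ⟩
    ∑ (λ j → ∑ (λ l → (M i j * B l j) * N i l))
      ≈⟨ ∑-swap {n} {p} (λ j l → (M i j * B l j) * N i l) ⟩
    ∑ (λ l → ∑ (λ j → (M i j * B l j) * N i l))
      ≈⟨ ∑-cong {p} (λ l → sym (∑-*ʳ (N i l) (λ j → M i j * B l j))) ⟩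
    ∑ (λ l → ∑ (λ j → M i j * B l j) * N i l) ∎)
    where
    open ≈-Reasoning
    regroup : ∀ x y z → x * (y * z) ≈ (x * z) * y
    regroup = solve 3 (λ x y z → x :* (y :* z) := (x :* z) :* y) refl

  adjoint : ∀ {m m' n n'} (M : Mat F m n) (A : Mat F m m') (N : Mat F m' n') (B : Mat F n' n) →
            ⟪ M , (A ⊗ N) ⊗ B ⟫ ≈ ⟪ (tr A ⊗ M) ⊗ tr B , N ⟫
  adjoint M A N B = begin
    ⟪ M , (A ⊗ N) ⊗ B ⟫          ≈⟨ adjointʳ M (A ⊗ N) B ⟩
    ⟪ M ⊗ tr B , A ⊗ N ⟫         ≈⟨ adjointˡ (M ⊗ tr B) A N ⟩
    ⟪ tr A ⊗ (M ⊗ tr B) , N ⟫    ≈⟨ pairing-cong (≈ₘ.sym (⊗-assoc (tr A) M (tr B))) ≈ₘ.refl ⟩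
    ⟪ (tr A ⊗ M) ⊗ tr B , N ⟫    ∎
    where open ≈-Reasoning

  -- β(M, N) = Σ M_ij N_kl β₁(e_i,e_k) β₂(e_j,e_l) = ⟪ M , G₁ N G₂ᵀ ⟫ = ⟪ G₁ᵀ M G₂ , N ⟫
  tensorForm-as-pairing : ∀ (β₁ : BilinearForm F 2) (β₂ : BilinearForm F 3) M N →
    tensorForm F β₁ β₂ M N ≈ ⟪ (tr (gram β₁) ⊗ M) ⊗ gram β₂ , N ⟫
  tensorForm-as-pairing β₁ β₂ M N = begin
    ∑ (λ i → ∑ (λ j → ∑ (λ k → ∑ (λ l → (M i j * N k l) * (G₁ i k * G₂ j l)))))
      ≈⟨ ∑-cong {2} (λ i → ∑-cong {3} (λ j → ∑-cong {2} (λ k → ∑-cong {3} (λ l →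
           regroup (M i j) (N k l) (G₁ i k) (G₂ j l))))) ⟩
    ∑ (λ i → ∑ (λ j → ∑ (λ k → ∑ (λ l → M i j * ((G₁ i k * N k l) * G₂ j l)))))
      ≈⟨ ∑-cong {2} (λ i → ∑-cong {3} (λ j →
           trans (∑-swap {2} {3} (λ k l → M i j * ((G₁ i k * N k l) * G₂ j l))) (sym (row i j)))) ⟩
    ⟪ M , (G₁ ⊗ N) ⊗ tr G₂ ⟫
      ≈⟨ adjoint M G₁ N (tr G₂) ⟩
    ⟪ (tr G₁ ⊗ M) ⊗ G₂ , N ⟫ ∎
    where
    open ≈-Reasoning
    G₁ : Mat F 2 2
    G₁ = gram β₁
    G₂ : Mat F 3 3
    G₂ = gram β₂
    regroup : ∀ x y g h → (x * y) * (g * h) ≈ x * ((g * y) * h)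
    regroup = solve 4 (λ x y g h → (x :* y) :* (g :* h) := x :* ((g :* y) :* h)) refl
    row : ∀ i j → M i j * ((G₁ ⊗ N) ⊗ tr G₂) i j
                ≈ ∑ (λ l → ∑ (λ k → M i j * ((G₁ i k * N k l) * G₂ j l)))
    row i j = trans (∑-*ˡ (M i j) (λ l → ∑ (λ k → G₁ i k * N k l) * G₂ j l))
                    (∑-cong {3} (λ l → trans (*-congˡ (∑-*ʳ (G₂ j l) (λ k → G₁ i k * N k l)))
                                              (∑-*ˡ (M i j) (λ k → (G₁ i k * N k l) * G₂ j l))))

  ⊥-transport : ∀ {S : Subset23 F} {b b' : Mat F 2 3 → Mat F 2 3 → Carrier} (f : Mat F 2 3 → Mat F 2 3) →
                (∀ M N → b M N ≈ b' (f M) N) → ∀ M → _⊥[_] F S b M ⇔ _⊥[_] F S b' (f M)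
  ⊥-transport f b≈b' M = mk⇔ (λ M⊥S N SN → trans (sym (b≈b' M N)) (M⊥S N SN))
                             (λ fM⊥S N SN → trans (b≈b' M N) (fM⊥S N SN))

  reassociate : ∀ {a b m n d e} (P : Mat F a b) (Q : Mat F b m) (X : Mat F m n) (R : Mat F n d) (S : Mat F d e) →
                ((P ⊗ Q) ⊗ X) ⊗ (R ⊗ S) ≈ₘ (P ⊗ ((Q ⊗ X) ⊗ R)) ⊗ S
  reassociate P Q X R S = begin
    ((P ⊗ Q) ⊗ X) ⊗ (R ⊗ S)    ≈⟨ ⊗-congˡ (R ⊗ S) (⊗-assoc P Q X) ⟩
    (P ⊗ (Q ⊗ X)) ⊗ (R ⊗ S)    ≈⟨ ⊗-assoc (P ⊗ (Q ⊗ X)) R S ⟨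
    ((P ⊗ (Q ⊗ X)) ⊗ R) ⊗ S    ≈⟨ ⊗-congˡ S (⊗-assoc P (Q ⊗ X) R) ⟩
    (P ⊗ ((Q ⊗ X) ⊗ R)) ⊗ S    ∎
    where open ≈ₘ-Reasoning

  -- If S is the preimage of T under M ↦ A M B with A, B invertible, and T is
  -- in the H₂-orbit of U, then so is S: S = A⁻¹ T B⁻¹ = (A⁻¹ g) U (hᵀ B⁻¹).
  preimage-orbit : ∀ {S T : Subset23 F} (A : Mat F 2 2) (B : Mat F 3 3) →
    Invertible F A → Invertible F B → (∀ M → S M ⇔ T ((A ⊗ M) ⊗ B)) →
    SameH₂Orbit F T (U F) → SameH₂Orbit F S (U F)
  preimage-orbit {S} {T} A B (A' , AA' , A'A) (B' , BB' , B'B) S⇔T (g , h , inv-g , inv-h , T≐gUh) =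
    A' ⊗ g , tr (tr h ⊗ B') ,
    invertible-⊗ A' g (A , A'A , AA') inv-g ,
    invertible-tr (tr h ⊗ B') (invertible-⊗ (tr h) B' (invertible-tr h inv-h) (B , B'B , BB')) ,
    λ M → mk⇔ (to M) (from M)
    where
    open ≈ₘ-Reasoning
    to : ∀ M → S M → act F (A' ⊗ g) (tr (tr h ⊗ B')) (U F) M
    to M SM with Equivalence.to (T≐gUh _) (Equivalence.to (S⇔T M) SM)
    ... | N , UN , AMB≈gNh = N , UN , (begin
      M                                ≈⟨ unsandwich A' A M B B' A'A BB' ⟨
      (A' ⊗ ((A ⊗ M) ⊗ B)) ⊗ B'        ≈⟨ ⊗-congˡ B' (⊗-congʳ A' AMB≈gNh) ⟩
      (A' ⊗ ((g ⊗ N) ⊗ tr h)) ⊗ B'     ≈⟨ reassociate A' g N (tr h) B' ⟨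
      ((A' ⊗ g) ⊗ N) ⊗ (tr h ⊗ B')     ∎)
    from : ∀ M → act F (A' ⊗ g) (tr (tr h ⊗ B')) (U F) M → S M
    from M (N , UN , M≈gNh) = Equivalence.from (S⇔T M) (Equivalence.from (T≐gUh _) (N , UN , AMB≈gNh))
      where
      AMB≈gNh : (A ⊗ M) ⊗ B ≈ₘ (g ⊗ N) ⊗ tr h
      AMB≈gNh = begin
        (A ⊗ M) ⊗ B                                ≈⟨ ⊗-congˡ B (⊗-congʳ A M≈gNh) ⟩
        (A ⊗ (((A' ⊗ g) ⊗ N) ⊗ (tr h ⊗ B'))) ⊗ B   ≈⟨ ⊗-congˡ B (⊗-congʳ A (reassociate A' g N (tr h) B')) ⟩
        (A ⊗ ((A' ⊗ ((g ⊗ N) ⊗ tr h)) ⊗ B')) ⊗ B   ≈⟨ unsandwich A A' ((g ⊗ N) ⊗ tr h) B' B AA' B'B ⟩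
        (g ⊗ N) ⊗ tr h                             ∎

  K⁻¹-inverse : (K ⊗ K⁻¹ ≈ₘ I) × (K⁻¹ ⊗ K ≈ₘ I)
  K⁻¹-inverse = fin₂ (fin₂ (right.entry f0 f0 refl) (right.entry f0 f1 refl))
                     (fin₂ (right.entry f1 f0 refl) (right.entry f1 f1 refl))
              , fin₂ (fin₂ (left.entry f0 f0 refl) (left.entry f0 f1 refl))
                     (fin₂ (left.entry f1 f0 refl) (left.entry f1 f1 refl))
    where
    module right = Entrywise Vec.[] (Poly.K Poly.∙ Poly.K⁻¹) Poly.δ
    module left  = Entrywise Vec.[] (Poly.K⁻¹ Poly.∙ Poly.K) Poly.δ

  Q-involutive : Q ⊗ Q ≈ₘ I
  Q-involutive = fin₃ (fin₃ (entry f0 f0 refl) (entry f0 f1 refl) (entry f0 f2 refl))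
                      (fin₃ (entry f1 f0 refl) (entry f1 f1 refl) (entry f1 f2 refl))
                      (fin₃ (entry f2 f0 refl) (entry f2 f1 refl) (entry f2 f2 refl))
    where open Entrywise Vec.[] (Poly.Q Poly.∙ Poly.Q) Poly.δ

  K-U-Qᵀ : ∀ x y z → (K ⊗ mat23 F x y 0# y z 0#) ⊗ tr Q ≈ₘ mat23 F (- y) 0# (- z) x 0# y
  K-U-Qᵀ x y z = fin₂ (fin₃ (entry f0 f0 refl) (entry f0 f1 refl) (entry f0 f2 refl))
                     (fin₃ (entry f1 f0 refl) (entry f1 f1 refl) (entry f1 f2 refl))
    where
    X Y Z O : Polynomial 3
    X = var f0
    Y = var f1
    Z = var f2
    O = con (0 , 0)
    open Entrywise (x Vec.∷ y Vec.∷ z Vec.∷ Vec.[])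
      ((Poly.K Poly.∙ Poly.matrix₂₃ X Y O Y Z O) Poly.∙ (λ k l → Poly.Q l k))
      (Poly.matrix₂₃ (:- Y) O (:- Z) X O Y)

  -- pairings of P with the spanning set [1,0,0|0,0,1], [0,1,0|0,0,0], [0,0,0|0,1,0] of W
  pairing-with-W-basis : ∀ P → (⟪ P , mat23 F 1# 0# 0# 0# 0# 1# ⟫ ≈ P f0 f0 + P f1 f2)
                             × (⟪ P , mat23 F 0# 1# 0# 0# 0# 0# ⟫ ≈ P f0 f1)
                             × (⟪ P , mat23 F 0# 0# 0# 0# 1# 0# ⟫ ≈ P f1 f1)
  pairing-with-W-basis P =
    prove (entries P) (Poly.⟪ X , Poly.matrix₂₃ L O O O O L ⟫) (X f0 f0 :+ X f1 f2) refl ,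
    prove (entries P) (Poly.⟪ X , Poly.matrix₂₃ O L O O O O ⟫) (X f0 f1) refl ,
    prove (entries P) (Poly.⟪ X , Poly.matrix₂₃ O O O O L O ⟫) (X f1 f1) refl
    where
    X : Fin 2 → Fin 3 → Polynomial 6
    X = variables
    O L : Polynomial 6
    O = con (0 , 0)
    L = con (1 , 0)

  K-U-Qᵀ-orthogonal-W : ∀ x y z x' y' z' →
    ⟪ mat23 F (- y) 0# (- z) x 0# y , mat23 F x' y' 0# 0# z' x' ⟫ ≈ 0#
  K-U-Qᵀ-orthogonal-W = solve 6 (λ x y z x' y' z' →
    Poly.⟪ Poly.matrix₂₃ (:- y) O (:- z) x O y , Poly.matrix₂₃ x' y' O O z' x' ⟫ := O) refl
    where
    O : Polynomial 6
    O = con (0 , 0)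

  -- W⊥ for the trace pairing is K U Qᵀ = {[a,0,c | d,0,-a]}
  annihilator-orbit : SameH₂Orbit F (_⊥[_] F (W F) ⟪_,_⟫) (U F)
  annihilator-orbit = K , Q , (K⁻¹ , K⁻¹-inverse) , (Q , Q-involutive , Q-involutive) , λ P → mk⇔ (to P) (from P)
    where
    to : ∀ P → _⊥[_] F (W F) ⟪_,_⟫ P → act F K Q (U F) P
    to P P⊥W = mat23 F x y 0# y z 0# , (x , y , z , λ _ _ → refl) , ≈ₘ.trans P≈ (≈ₘ.sym (K-U-Qᵀ x y z))
      where
      x y z : Carrier
      x = P f1 f0
      y = - P f0 f0
      z = - P f0 f2
      orthogonal : ∀ a b c' → ⟪ P , mat23 F a b 0# 0# c' a ⟫ ≈ 0#
      orthogonal a b c' = P⊥W _ (a , b , c' , λ _ _ → refl)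
      P₀₀+P₁₂≈0 : P f0 f0 + P f1 f2 ≈ 0#
      P₀₀+P₁₂≈0 = trans (sym (proj₁ (pairing-with-W-basis P))) (orthogonal 1# 0# 0#)
      P₀₁≈0 : P f0 f1 ≈ 0#
      P₀₁≈0 = trans (sym (proj₁ (proj₂ (pairing-with-W-basis P)))) (orthogonal 0# 1# 0#)
      P₁₁≈0 : P f1 f1 ≈ 0#
      P₁₁≈0 = trans (sym (proj₂ (proj₂ (pairing-with-W-basis P)))) (orthogonal 0# 0# 1#)
      P≈ : P ≈ₘ mat23 F (- y) 0# (- z) x 0# y
      P≈ = fin₂ (fin₃ (sym (-‿involutive _)) P₀₁≈0 (sym (-‿involutive _)))
                (fin₃ refl P₁₁≈0 (+-inverseʳ-unique _ _ P₀₀+P₁₂≈0))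
    from : ∀ P → act F K Q (U F) P → _⊥[_] F (W F) ⟪_,_⟫ P
    from P (N , (x , y , z , N≈) , P≈KNQ) N' (x' , y' , z' , N'≈) = begin
      ⟪ P , N' ⟫
        ≈⟨ pairing-cong (≈ₘ.trans P≈KNQ (≈ₘ.trans (⊗-congˡ (tr Q) (⊗-congʳ K N≈)) (K-U-Qᵀ x y z)))
                        N'≈ ⟩
      ⟪ mat23 F (- y) 0# (- z) x 0# y , mat23 F x' y' 0# 0# z' x' ⟫
        ≈⟨ K-U-Qᵀ-orthogonal-W x y z x' y' z' ⟩
      0# ∎
      where open ≈-Reasoning

mainTheorem6 : {c ℓ : Level} (F : Field c ℓ)
    (β₁ : BilinearForm F 2) (β₂ : BilinearForm F 3) →
    IsSymmetricBilinear F β₁ → Nondegenerate F β₁ →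
    IsSymmetricBilinear F β₂ → Nondegenerate F β₂ →
    SameH₂Orbit F (_⊥[_] F (W F) (tensorForm F β₁ β₂)) (U F)
-- W⊥ is the preimage, under M ↦ G₁ᵀ M G₂, of the trace-pairing complement
-- of W, which lies in the orbit of U; G₁ᵀ and G₂ are invertible because the
-- forms are nondegenerate.
mainTheorem6 F β₁ β₂ isβ₁ nondegenerate₁ isβ₂ nondegenerate₂ =
  preimage-orbit (tr G₁) G₂
                 (invertible-tr G₁ (invertible₂ G₁ (gram-kernel isβ₁ nondegenerate₁)))
                 (invertible₃ G₂ (gram-kernel isβ₂ nondegenerate₂))
                 (⊥-transport {b' = ⟪_,_⟫} (λ M → (tr G₁ ⊗ M) ⊗ G₂) (tensorForm-as-pairing β₁ β₂))
                 annihilator-orbit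
  where
  open LinearAlgebra F
  G₁ : Mat F 2 2
  G₁ = gram β₁
  G₂ : Mat F 3 3
  G₂ = gram β₂
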